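{- Let $i$ be a positive integer, let $C$ be a level component in $L_i$, and let $U\subseteq L_{i-1}$ be the set of vertices of $L_{i-1}$ having a neighbor in $C$. (i) If $C=C(A,B,K)$ is a $2$-clique, then for every $u\in U$, either $N^+(u)=A\cup K$ or $N^+(u)=B\cup K$. (ii) If $C$ is a clique, then the vertices of $U$ can be ordered $u_1,\dots,u_\ell$ so that $N^+(u_1)\subseteq N^+(u_2)\subseteq\cdots\subseteq N^+(u_\ell)=V(C)$.
   Context: Let $G$ be a graph with no induced claw ($K_{1,3}$) and no even hole (induced cycle of even length at least $4$). Fix two adjacent vertices $u_0,u_1$ of $G$, let $B_0=N_G(u_0)\setminus\{u_1\}$, and let $G_0$ be the connected component of $G-B_0$ containing $u_0$. For $j\ge 0$, $L_j=\{u\in V(G_0): d_{G_0}(u,u_0)=j\}$. For $v\in L_i$, $N^+(v)=N_G(v)\cap L_{i+1}$. A level component in $L_i$ is a connected component of $G_0[L_i]$. A $2$-clique $C(A,B,K)$ is a connected graph whose vertex set is partitioned into three nonempty sets $A,B,K$ such that $A\cup K$ and $B\cup K$ are cliques and no vertex of $A$ is adjacent to a vertex of $B$. -}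

module Defs where

open import Data.Nat using (ℕ; zero; suc; _+_; _∸_; _<_; _≤_)
open import Data.Fin using (Fin; toℕ)
open import Data.Bool using (Bool; true; false)
open import Data.Product using (Σ; ∃; _×_; _,_)
open import Data.Sum using (_⊎_)
open import Relation.Binary.PropositionalEquality using (_≡_; _≢_)
open import Relation.Nullary using (¬_)
open import Function.Definitions using (Injective)

record Graph (n : ℕ) : Set where
  field
    adj   : Fin n → Fin n → Bool
    sym   : ∀ x y → adj x y ≡ adj y x
    irref : ∀ x → adj x x ≡ false

open Graph public

module _ {n : ℕ} (G : Graph n) where

  E : Fin n → Fin n → Set
  E x y = adj G x y ≡ true

  ClawFree : Set
  ClawFree = ∀ (a b c d : Fin n) → b ≢ c → b ≢ d → c ≢ d →
             E a b → E a c → E a d →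
             ¬ E b c → ¬ E b d → ¬ E c d → Data.Empty.⊥
    where import Data.Empty

  CycAdj : (k : ℕ) → Fin k → Fin k → Set
  CycAdj k j l = (suc (toℕ j) ≡ toℕ l) ⊎ (suc (toℕ l) ≡ toℕ j)
               ⊎ ((toℕ j ≡ 0) × (toℕ l ≡ k ∸ 1))
               ⊎ ((toℕ l ≡ 0) × (toℕ j ≡ k ∸ 1))

  IsHole : (k : ℕ) → (Fin k → Fin n) → Set
  IsHole k f = Injective _≡_ _≡_ f ×
               (∀ j l → (E (f j) (f l) → CycAdj k j l) × (CycAdj k j l → E (f j) (f l)))

  EvenHoleFree : Set
  EvenHoleFree = ∀ (m : ℕ) → 2 ≤ m → (f : Fin (m + m) → Fin n) → ¬ IsHole (m + m) f

  data WalkIn (S : Fin n → Set) : Fin n → Fin n → ℕ → Set where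
    here : ∀ {x} → S x → WalkIn S x x 0
    step : ∀ {x y z k} → S x → E x y → WalkIn S y z k → WalkIn S x z (suc k)

  DistIn : (S : Fin n → Set) → Fin n → Fin n → ℕ → Set
  DistIn S x y k = WalkIn S x y k × (∀ m → m < k → ¬ WalkIn S x y m)

  Clique : (Fin n → Set) → Set
  Clique S = ∀ x y → S x → S y → x ≢ y → E x y

  module Levels (u0 u1 : Fin n) where

    B0 : Fin n → Set
    B0 v = E u0 v × v ≢ u1

    GminusB0 : Fin n → Set
    GminusB0 v = ¬ B0 v

    V0 : Fin n → Set
    V0 v = ∃ λ k → WalkIn GminusB0 u0 v k

    -- L_j = vertices of G0 at distance j from u0 in G0
    -- (distances in G0 coincide with distances in G - B0, since G0 is a component)
    L : ℕ → Fin n → Set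
    L j v = DistIn GminusB0 u0 v j

    Nplus : ℕ → Fin n → Fin n → Set
    Nplus i v w = E v w × L (suc i) w

    LevelComponent : ℕ → (Fin n → Set) → Set
    LevelComponent i C =
      (∃ λ v → C v) ×
      (∀ v → C v → L i v) ×
      (∀ x y → C x → C y → ∃ λ k → WalkIn C x y k) ×
      (∀ x y → C x → L i y → E x y → C y)

    -- U = vertices of L_{i-1} with a neighbour in C (here i = suc p)
    Upper : ℕ → (Fin n → Set) → Fin n → Set
    Upper p C u = L p u × ∃ λ w → C w × E u w

  -- C(A,B,K) is a 2-clique with vertex set C: A,B,K nonempty and partition C,
  -- A∪K and B∪K cliques, no A–B edges (connectivity is implied by K ≠ ∅)
  TwoClique : (C A B K : Fin n → Set) → Set
  TwoClique C A B K =
    (∃ λ a → A a) × (∃ λ b → B b) × (∃ λ c → K c) ×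
    (∀ v → (C v → A v ⊎ B v ⊎ K v) × (A v ⊎ B v ⊎ K v → C v)) ×
    (∀ v → A v → B v → Data.Empty.⊥) ×
    (∀ v → A v → K v → Data.Empty.⊥) ×
    (∀ v → B v → K v → Data.Empty.⊥) ×
    Clique (λ v → A v ⊎ K v) × Clique (λ v → B v ⊎ K v) ×
    (∀ a b → A a → B b → ¬ E a b)
    where import Data.Empty

_⊆ᵥ_ : {n : ℕ} → (Fin n → Set) → (Fin n → Set) → Set
S ⊆ᵥ T = ∀ v → S v → T v

_≐ᵥ_ : {n : ℕ} → (Fin n → Set) → (Fin n → Set) → Set
S ≐ᵥ T = (S ⊆ᵥ T) × (T ⊆ᵥ S)

{-# OPTIONS --safe #-}
-- Claw-freeness makes N⁺(x) a clique for every x: a parent of x together with two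
-- non-adjacent up-neighbours of x would form a claw. The central fact is that no
-- induced path s–a–b–s' has s, s' ∈ L_p and a, b ∈ L_{p+1}. More generally there is
-- no induced path with an odd number (at least 3) of edges whose ends lie in L_q and
-- whose inner vertices lie deeper: attaching parents of its two ends either closes an
-- even hole or gives such a path hanging from L_{q-1}, and in L_0 the ends coincide.
-- (i) A vertex of U seeing A must see all of K, or such a P₄ appears, and then all of
-- A, or there is a claw at a vertex of K. (ii) Two vertices of U with incomparable N⁺
-- span such a P₄, so the sets N⁺(u) form a chain; sorting U by inclusion gives the
-- order, and its last member sees all of C since every vertex of C has a parent in U.
module Submission where

open import Defs hiding (sym)
open import Data.Nat using (ℕ; zero; suc; _+_; _≤_; _<_; z≤n; s≤s; s≤s⁻¹; _≤?_; _≟_)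
open import Data.Nat.Properties
  using (≤-refl; ≤-trans; ≤-antisym; ≰⇒>; n≮n; <-cmp; +-suc; ≤∧≢⇒<; n≤1+n; m≤n⇒m<n∨m≡n; allUpTo?)
open import Data.Fin using (Fin; zero; suc; toℕ; fromℕ) renaming (_≟_ to _≟ᶠ_; _<_ to _<ᶠ_)
open import Data.Fin.Properties
  using (toℕ-injective; toℕ<n; ≤fromℕ; any?; all?) renaming (<-cmp to <ᶠ-cmp)
open import Data.Bool using (true) renaming (_≟_ to _≟ᵇ_)
open import Data.List using (List; []; _∷_; foldr; length; lookup; filter; allFin)
open import Data.List.Relation.Unary.All using (All; []; _∷_)
import Data.List.Relation.Unary.All as All
open import Data.List.Relation.Unary.All.Properties using (all-filter)
open import Data.List.Relation.Unary.AllPairs using (AllPairs; []; _∷_)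
open import Data.List.Relation.Unary.Unique.Propositional using (Unique)
import Data.List.Relation.Unary.Unique.Propositional.Properties as Unique
open import Data.List.Membership.Propositional using (_∈_)
open import Data.List.Membership.Propositional.Properties using (∈-lookup; ∈-filter⁺; ∈-allFin)
open import Data.List.Relation.Binary.Permutation.Propositional
  using (_↭_; ↭-refl; ↭-prep; ↭-swap; ↭-trans; ↭-sym; ↭⇒↭ₛ)
open import Data.List.Relation.Binary.Permutation.Propositional.Properties using (All-resp-↭; ∈-resp-↭)
import Data.List.Relation.Binary.Permutation.Setoid.Properties as PermutationSetoid
open import Data.List.Relation.Unary.Any using (index)
open import Data.List.Relation.Unary.Any.Properties using (lookup-index)
open import Data.Sum using (_⊎_; inj₁; inj₂; [_,_]′)
open import Data.Product using (∃; Σ; _×_; _,_; proj₁; proj₂)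
open import Data.Empty using (⊥; ⊥-elim)
open import Function using (_∘_; id)
open import Function.Definitions using (Injective)
open import Relation.Nullary using (¬_; Dec; yes; no)
open import Relation.Nullary.Decidable using (_×-dec_; _⊎-dec_; _→-dec_; ¬?; map′)
open import Relation.Binary using (tri<; tri≈; tri>)
open import Relation.Binary.PropositionalEquality using (_≡_; _≢_; refl; sym; trans; cong; subst; setoid)

module GraphBasics {n : ℕ} (G : Graph n) where

  E? : ∀ x y → Dec (E G x y)
  E? x y = adj G x y ≟ᵇ true

  E-sym : ∀ {x y} → E G x y → E G y x
  E-sym {x} {y} = trans (Graph.sym G y x)

  E-irrefl : ∀ {x} → ¬ E G x x
  E-irrefl {x} e with trans (sym (irref G x)) e
  ... | ()

  E⇒≢ : ∀ {x y} → E G x y → x ≢ y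
  E⇒≢ e refl = E-irrefl e

module Paths {n : ℕ} (G : Graph n) where
  open GraphBasics G

  Consecutive : ℕ → ℕ → Set
  Consecutive j l = suc j ≡ l ⊎ suc l ≡ j

  -- On toℕ of the indices this is exactly CycAdj G (suc N).
  CyclicallyConsecutive : ℕ → ℕ → ℕ → Set
  CyclicallyConsecutive N j l = suc j ≡ l ⊎ suc l ≡ j ⊎ (j ≡ 0 × l ≡ N) ⊎ (l ≡ 0 × j ≡ N)

  -- h 0, …, h N is a path of G in which h j, h l can be adjacent only when Adj j l;
  -- the values of h beyond N play no role.
  record Induced (Adj : ℕ → ℕ → Set) (N : ℕ) (h : ℕ → Fin n) : Set where
    field
      injective : ∀ {j l} → j ≤ N → l ≤ N → h j ≡ h l → j ≡ l
      edge      : ∀ {j} → j < N → E G (h j) (h (suc j))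
      only      : ∀ {j l} → j ≤ N → l ≤ N → E G (h j) (h l) → Adj j l

  InducedPath : ℕ → (ℕ → Fin n) → Set
  InducedPath = Induced Consecutive

  hole-or-inducedPath : ∀ {N h} → Induced (CyclicallyConsecutive N) N h →
                        IsHole G (suc N) (h ∘ toℕ) ⊎ InducedPath N h
  hole-or-inducedPath {N} {h} P with E? (h 0) (h N)
  ... | yes e = inj₁ ((λ {i} {j} eq → toℕ-injective (injective (bound i) (bound j) eq)) ,
                      λ i j → only (bound i) (bound j) ,
                              cyclicEdge (toℕ i) (toℕ j) (bound j) (bound i))
    where
      open Induced P
      bound : (i : Fin (suc N)) → toℕ i ≤ N
      bound i = s≤s⁻¹ (toℕ<n i)
      cyclicEdge : ∀ j l → l ≤ N → j ≤ N → CyclicallyConsecutive N j l → E G (h j) (h l)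
      cyclicEdge j _ l≤N _ (inj₁ refl) = edge l≤N
      cyclicEdge _ l _ j≤N (inj₂ (inj₁ refl)) = E-sym (edge j≤N)
      cyclicEdge _ _ _ _ (inj₂ (inj₂ (inj₁ (refl , refl)))) = e
      cyclicEdge _ _ _ _ (inj₂ (inj₂ (inj₂ (refl , refl)))) = E-sym e
  ... | no ¬e = inj₂ (record { injective = injective ; edge = edge ; only = consecutive })
    where
      open Induced P
      consecutive : ∀ {j l} → j ≤ N → l ≤ N → E G (h j) (h l) → Consecutive j l
      consecutive j≤N l≤N e with only j≤N l≤N e
      ... | inj₁ c = inj₁ c
      ... | inj₂ (inj₁ c) = inj₂ c
      ... | inj₂ (inj₂ (inj₁ (refl , refl))) = ⊥-elim (¬e e)
      ... | inj₂ (inj₂ (inj₂ (refl , refl))) = ⊥-elim (¬e (E-sym e))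

  InducedPath-ends-≢ : ∀ {m h} → InducedPath (2 + m) h → h 0 ≢ h (2 + m)
  InducedPath-ends-≢ P eq with Induced.injective P z≤n ≤-refl eq
  ... | ()

  InducedPath-ends-¬E : ∀ {m h} → InducedPath (2 + m) h → ¬ E G (h 0) (h (2 + m))
  InducedPath-ends-¬E P e with Induced.only P z≤n ≤-refl e
  ... | inj₁ ()
  ... | inj₂ ()

  pair : Fin n → Fin n → ℕ → Fin n
  pair a b zero    = a
  pair a b (suc _) = b

  edgePath : ∀ {a b} → E G a b → InducedPath 1 (pair a b)
  edgePath {a} {b} ab = record { injective = injective ; edge = λ { (s≤s z≤n) → ab } ; only = only }
    where
      injective : ∀ {j l} → j ≤ 1 → l ≤ 1 → pair a b j ≡ pair a b l → j ≡ l
      injective z≤n       z≤n       _  = refl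
      injective z≤n       (s≤s z≤n) eq = ⊥-elim (E⇒≢ ab eq)
      injective (s≤s z≤n) z≤n       eq = ⊥-elim (E⇒≢ ab (sym eq))
      injective (s≤s z≤n) (s≤s z≤n) _  = refl
      only : ∀ {j l} → j ≤ 1 → l ≤ 1 → E G (pair a b j) (pair a b l) → Consecutive j l
      only z≤n       z≤n       e = ⊥-elim (E-irrefl e)
      only z≤n       (s≤s z≤n) _ = inj₁ refl
      only (s≤s z≤n) z≤n       _ = inj₂ refl
      only (s≤s z≤n) (s≤s z≤n) e = ⊥-elim (E-irrefl e)

  module Extension (t t' : Fin n) (h : ℕ → Fin n) (M : ℕ) where

    extend : ℕ → Fin n
    extend zero = t
    extend (suc k) with k ≤? M
    ... | yes _ = h k
    ... | no _  = t'

    extend-inner : ∀ {k} → k ≤ M → extend (suc k) ≡ h k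
    extend-inner {k} k≤M with k ≤? M
    ... | yes _   = refl
    ... | no k≰M = ⊥-elim (k≰M k≤M)

    extend-last : extend (2 + M) ≡ t'
    extend-last with suc M ≤? M
    ... | yes M<M = ⊥-elim (n≮n M M<M)
    ... | no _    = refl

    data Position : ℕ → Set where
      first : Position 0
      inner : ∀ {k} → k ≤ M → Position (suc k)
      last  : Position (2 + M)

    position : ∀ {j} → j ≤ 2 + M → Position j
    position {zero}  _ = first
    position {suc k} k<2+M with k ≤? M
    ... | yes k≤M = inner k≤M
    ... | no k≰M rewrite ≤-antisym (s≤s⁻¹ k<2+M) (≰⇒> k≰M) = last

    record Attached : Set where
      field
        t-fresh  : ∀ {k} → k ≤ M → t ≢ h k
        t'-fresh : ∀ {k} → k ≤ M → t' ≢ h k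
        t≢t'     : t ≢ t'
        t-edge   : E G t (h 0)
        t'-edge  : E G t' (h M)
        t-only   : ∀ {k} → k ≤ M → E G t (h k) → k ≡ 0
        t'-only  : ∀ {k} → k ≤ M → E G t' (h k) → k ≡ M

    extend-induced : InducedPath M h → Attached →
                     Induced (CyclicallyConsecutive (2 + M)) (2 + M) extend
    extend-induced P A = record
      { injective = λ j≤ l≤ → injective (position j≤) (position l≤)
      ; edge      = edge
      ; only      = λ j≤ l≤ → only (position j≤) (position l≤)
      }
      where
        open Attached A
        module P = Induced P

        injective : ∀ {j l} → Position j → Position l → extend j ≡ extend l → j ≡ l
        injective first       first        _  = refl
        injective first       (inner l≤M)  eq rewrite extend-inner l≤M = ⊥-elim (t-fresh l≤M eq)
        injective first       last         eq rewrite extend-last = ⊥-elim (t≢t' eq)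
        injective (inner j≤M) first        eq rewrite extend-inner j≤M = ⊥-elim (t-fresh j≤M (sym eq))
        injective (inner j≤M) (inner l≤M)  eq rewrite extend-inner j≤M | extend-inner l≤M =
          cong suc (P.injective j≤M l≤M eq)
        injective (inner j≤M) last         eq rewrite extend-inner j≤M | extend-last =
          ⊥-elim (t'-fresh j≤M (sym eq))
        injective last        first        eq rewrite extend-last = ⊥-elim (t≢t' (sym eq))
        injective last        (inner l≤M)  eq rewrite extend-inner l≤M | extend-last =
          ⊥-elim (t'-fresh l≤M eq)
        injective last        last         _  = refl

        edge : ∀ {j} → j < 2 + M → E G (extend j) (extend (suc j))
        edge {zero}  _ rewrite extend-inner {0} z≤n = t-edge
        edge {suc k} k<1+M with position {suc (suc k)} k<1+M
        ... | inner k<M rewrite extend-inner (≤-trans (n≤1+n k) k<M) | extend-inner k<M = P.edge k<M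
        ... | last rewrite extend-inner {M} ≤-refl | extend-last = E-sym t'-edge

        only : ∀ {j l} → Position j → Position l → E G (extend j) (extend l) →
               CyclicallyConsecutive (2 + M) j l
        only first       first        e = ⊥-elim (E-irrefl e)
        only first       (inner l≤M)  e rewrite extend-inner l≤M = inj₁ (cong suc (sym (t-only l≤M e)))
        only first       last         _ = inj₂ (inj₂ (inj₁ (refl , refl)))
        only (inner j≤M) first        e rewrite extend-inner j≤M =
          inj₂ (inj₁ (cong suc (sym (t-only j≤M (E-sym e)))))
        only (inner j≤M) (inner l≤M)  e rewrite extend-inner j≤M | extend-inner l≤M
          with P.only j≤M l≤M e
        ... | inj₁ c = inj₁ (cong suc c)
        ... | inj₂ c = inj₂ (inj₁ (cong suc c))
        only (inner j≤M) last         e rewrite extend-inner j≤M | extend-last =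
          inj₁ (cong (2 +_) (t'-only j≤M (E-sym e)))
        only last        first        _ = inj₂ (inj₂ (inj₂ (refl , refl)))
        only last        (inner l≤M)  e rewrite extend-inner l≤M | extend-last =
          inj₂ (inj₁ (cong (2 +_) (t'-only l≤M e)))
        only last        last         e = ⊥-elim (E-irrefl e)

module LevelFacts {n : ℕ} (G : Graph n) (u0 u1 : Fin n) where
  open GraphBasics G
  open Levels G u0 u1

  Walk : Fin n → Fin n → ℕ → Set
  Walk = WalkIn G GminusB0

  walk-target : ∀ {x y k} → Walk x y k → GminusB0 y
  walk-target (here s)     = s
  walk-target (step _ _ w) = walk-target w

  walk-snoc : ∀ {x y z k} → Walk x y k → GminusB0 z → E G y z → Walk x z (suc k)
  walk-snoc (here s)      sz yz = step s yz (here sz)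
  walk-snoc (step s e w)  sz yz = step s e (walk-snoc w sz yz)

  walk-unsnoc : ∀ {x z k} → Walk x z (suc k) → ∃ λ y → Walk x y k × E G y z
  walk-unsnoc (step sx e (here _)) = _ , here sx , e
  walk-unsnoc (step sx e (step sy e' w)) with walk-unsnoc (step sy e' w)
  ... | y , w' , yz = y , step sx e w' , yz

  L-unique : ∀ {a b v} → L a v → L b v → a ≡ b
  L-unique {a} {b} (wa , minA) (wb , minB) with <-cmp a b
  ... | tri< a<b _ _ = ⊥-elim (minB a a<b wa)
  ... | tri≈ _ a≡b _ = a≡b
  ... | tri> _ _ b<a = ⊥-elim (minA b b<a wb)

  L-edge : ∀ {a b x y} → L a x → L b y → E G x y → b ≤ suc a
  L-edge {a} {b} (wx , _) (wy , minY) xy with b ≤? suc a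
  ... | yes b≤1+a = b≤1+a
  ... | no b≰1+a  = ⊥-elim (minY (suc a) (≰⇒> b≰1+a) (walk-snoc wx (walk-target wy) xy))

  parent : ∀ {a v} → L (suc a) v → ∃ λ w → L a w × E G w v
  parent (wv , minV) with walk-unsnoc wv
  ... | w , ww , wv' = w , (ww , shortest) , wv'
    where
      shortest : ∀ m → m < _ → ¬ Walk u0 w m
      shortest m m<a wm = minV (suc m) (s≤s m<a) (walk-snoc wm (walk-target wv) wv')

  L0⇒u0 : ∀ {v} → L 0 v → v ≡ u0
  L0⇒u0 (here _ , _) = refl

  L1⇒u1 : ∀ {v} → L 1 v → v ≡ u1
  L1⇒u1 {v} (step _ u0v (here sv) , _) with v ≟ᶠ u1
  ... | yes v≡u1 = v≡u1
  ... | no v≢u1  = ⊥-elim (sv (u0v , v≢u1))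

  L-<⇒≢ : ∀ {a b x y} → L a x → L b y → a < b → x ≢ y
  L-<⇒≢ lx ly a<b refl with L-unique lx ly
  ... | refl = n≮n _ a<b

  L-far⇒¬E : ∀ {a b x y} → L a x → L b y → suc a < b → ¬ E G x y
  L-far⇒¬E lx ly 1+a<b xy = n≮n _ (≤-trans 1+a<b (L-edge lx ly xy))

  GminusB0? : ∀ v → Dec (GminusB0 v)
  GminusB0? v = ¬? (E? u0 v ×-dec ¬? (v ≟ᶠ u1))

  walk? : ∀ x y k → Dec (Walk x y k)
  walk? x y zero with GminusB0? x | x ≟ᶠ y
  ... | yes sx | yes refl = yes (here sx)
  ... | no ¬sx | _        = no λ { (here sx) → ¬sx sx }
  ... | yes _  | no x≢y   = no λ { (here _) → x≢y refl }
  walk? x y (suc k) with GminusB0? x | any? (λ z → E? x z ×-dec walk? z y k)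
  ... | yes sx | yes (_ , xz , w) = yes (step sx xz w)
  ... | no ¬sx | _                = no λ { (step sx _ _) → ¬sx sx }
  ... | yes _  | no ¬next         = no λ { (step _ xz w) → ¬next (_ , xz , w) }

  L? : ∀ j v → Dec (L j v)
  L? j v = walk? u0 v j ×-dec map′ (λ shorter m → shorter {m}) (λ shorter {m} → shorter m)
                                    (allUpTo? (λ m → ¬? (walk? u0 v m)) j)

  Above : ℕ → Fin n → Set
  Above q v = ∃ λ q' → q < q' × L q' v

  Above-≢ : ∀ {q x v} → L q x → Above q v → x ≢ v
  Above-≢ lx (_ , q<q' , lv) = L-<⇒≢ lx lv q<q'

  Above-suc : ∀ {q v} → Above (suc q) v → Above q v
  Above-suc (q' , 1+q<q' , lv) = q' , ≤-trans (n≤1+n _) 1+q<q' , lv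

  Above-¬E : ∀ {q x v} → L q x → Above (suc q) v → ¬ E G x v
  Above-¬E lx (_ , 1+q<q' , lv) = L-far⇒¬E lx lv 1+q<q'

module ClawFreeEvenHoleFreeLevels {n : ℕ} (G : Graph n) (claw-free : ClawFree G)
                                  (even-hole-free : EvenHoleFree G) (u0 u1 : Fin n) where
  open GraphBasics G
  open Paths G
  open Levels G u0 u1
  open LevelFacts G u0 u1

  up-clique : ∀ {p x s s'} → L p x → L (suc p) s → L (suc p) s' →
              E G x s → E G x s' → s ≢ s' → E G s s'
  up-clique {zero} _ ls ls' _ _ s≢s' = ⊥-elim (s≢s' (trans (L1⇒u1 ls) (sym (L1⇒u1 ls'))))
  up-clique {suc p} lx ls ls' xs xs' s≢s' with E? _ _
  ... | yes ss' = ss'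
  ... | no ¬ss' with parent lx
  ... | y , ly , yx =
    ⊥-elim (claw-free _ y _ _ (L-<⇒≢ ly ls (s≤s (n≤1+n p))) (L-<⇒≢ ly ls' (s≤s (n≤1+n p))) s≢s'
                      (E-sym yx) xs xs' (L-far⇒¬E ly ls ≤-refl) (L-far⇒¬E ly ls' ≤-refl) ¬ss')

  noHoleOfLength : ∀ m {k f} → 2 ≤ m → k ≡ m + m → ¬ IsHole G k f
  noHoleOfLength m 2≤m refl = even-hole-free m 2≤m _

  record HangsFrom (q M : ℕ) (h : ℕ → Fin n) : Set where
    field
      start : L q (h 0)
      end   : L q (h M)
      inner : ∀ {k} → 0 < k → k < M → Above q (h k)

  NoHangingOddPath : ℕ → Set
  NoHangingOddPath q = ∀ r {h} → InducedPath (3 + (r + r)) h → HangsFrom q (3 + (r + r)) h → ⊥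

  noAttachedOddPath : ∀ {q M h t t'} r → M ≡ 1 + (r + r) → NoHangingOddPath q → InducedPath M h →
             (∀ {k} → k ≤ M → Above q (h k)) → L q t → L q t' →
             Extension.Attached t t' h M → ⊥
  noAttachedOddPath {q} {M} {h} {t} {t'} r refl noPath P above lt lt' A
    with hole-or-inducedPath (Extension.extend-induced t t' h M P A)
  ... | inj₁ hole = noHoleOfLength (2 + r) (s≤s (s≤s z≤n)) even hole
    where
      even : 4 + (r + r) ≡ (2 + r) + (2 + r)
      even = cong (2 +_) (sym (trans (+-suc r (suc r)) (cong suc (+-suc r r))))
  ... | inj₂ P' = noPath r P' record
    { start = lt
    ; end   = subst (L q) (sym extend-last) lt'
    ; inner = λ { {suc k} _ k<1+M → let k≤M = s≤s⁻¹ (s≤s⁻¹ k<1+M) in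
                    subst (Above q) (sym (extend-inner k≤M)) (above k≤M) }
    }
    where open Extension t t' h M

  noHangingOddPath : ∀ q → NoHangingOddPath q
  noHangingOddPath zero r P H = InducedPath-ends-≢ P (trans (L0⇒u0 start) (sym (L0⇒u0 end)))
    where open HangsFrom H
  noHangingOddPath (suc q) r {h} P H with parent (HangsFrom.start H) | parent (HangsFrom.end H)
  ... | t , lt , th₀ | t' , lt' , t'hM =
    noAttachedOddPath (suc r) (cong (2 +_) (sym (+-suc r r))) (noHangingOddPath q) P above lt lt' record
      { t-fresh  = Above-≢ lt ∘ above
      ; t'-fresh = Above-≢ lt' ∘ above
      ; t≢t'     = λ { refl → ¬commonParent lt th₀ t'hM }
      ; t-edge   = th₀
      ; t'-edge  = t'hM
      ; t-only   = t-only
      ; t'-only  = t'-only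
      }
    where
      open HangsFrom H using (start; end)
      M = 3 + (r + r)

      ¬commonParent : ∀ {x} → L q x → E G x (h 0) → E G x (h M) → ⊥
      ¬commonParent lx x₀ xM =
        InducedPath-ends-¬E P (up-clique lx start end x₀ xM (InducedPath-ends-≢ P))

      inner : ∀ {k} → k ≤ M → k ≢ 0 → k ≢ M → Above (suc q) (h k)
      inner k≤M k≢0 k≢M = HangsFrom.inner H (≤∧≢⇒< z≤n (k≢0 ∘ sym)) (≤∧≢⇒< k≤M k≢M)

      above : ∀ {k} → k ≤ M → Above q (h k)
      above {k} k≤M with k ≟ 0 | k ≟ M
      ... | yes refl | _        = suc q , ≤-refl , start
      ... | no _     | yes refl = suc q , ≤-refl , end
      ... | no k≢0   | no k≢M   = Above-suc (inner k≤M k≢0 k≢M)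

      t-only : ∀ {k} → k ≤ M → E G t (h k) → k ≡ 0
      t-only {k} k≤M tk with k ≟ 0 | k ≟ M
      ... | yes k≡0 | _        = k≡0
      ... | no _    | yes refl = ⊥-elim (¬commonParent lt th₀ tk)
      ... | no k≢0  | no k≢M   = ⊥-elim (Above-¬E lt (inner k≤M k≢0 k≢M) tk)

      t'-only : ∀ {k} → k ≤ M → E G t' (h k) → k ≡ M
      t'-only {k} k≤M t'k with k ≟ M | k ≟ 0
      ... | yes k≡M | _        = k≡M
      ... | no _    | yes refl = ⊥-elim (¬commonParent lt' t'k t'hM)
      ... | no k≢M  | no k≢0   = ⊥-elim (Above-¬E lt' (inner k≤M k≢0 k≢M) t'k)

  noInducedP₄ : ∀ {p s a b s'} → L p s → L (suc p) a → L (suc p) b → L p s' →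
                E G s a → E G a b → E G b s' → ¬ E G s b → ¬ E G a s' → s ≢ s' → ⊥
  noInducedP₄ {p} {s} {a} {b} {s'} ls la lb ls' sa ab bs' ¬sb ¬as' s≢s' =
    noAttachedOddPath 0 refl (noHangingOddPath p) (edgePath ab) above ls ls' record
      { t-fresh  = Above-≢ ls ∘ above
      ; t'-fresh = Above-≢ ls' ∘ above
      ; t≢t'     = s≢s'
      ; t-edge   = sa
      ; t'-edge  = E-sym bs'
      ; t-only   = λ { z≤n _ → refl ; (s≤s z≤n) sb → ⊥-elim (¬sb sb) }
      ; t'-only  = λ { z≤n s'a → ⊥-elim (¬as' (E-sym s'a)) ; (s≤s z≤n) _ → refl }
      }
    where
      above : ∀ {k} → k ≤ 1 → Above p (pair a b k)
      above z≤n       = suc p , ≤-refl , la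
      above (s≤s z≤n) = suc p , ≤-refl , lb

module InsertionSort {A : Set} (R : A → A → Set) (R? : ∀ x y → Dec (R x y)) where

  insert : A → List A → List A
  insert x []       = x ∷ []
  insert x (y ∷ ys) with R? x y
  ... | yes _ = x ∷ y ∷ ys
  ... | no _  = y ∷ insert x ys

  sort : List A → List A
  sort = foldr insert []

  insert-↭ : ∀ x ys → insert x ys ↭ x ∷ ys
  insert-↭ x []       = ↭-refl
  insert-↭ x (y ∷ ys) with R? x y
  ... | yes _ = ↭-refl
  ... | no _  = ↭-trans (↭-prep y (insert-↭ x ys)) (↭-swap y x ↭-refl)

  sort-↭ : ∀ xs → sort xs ↭ xs
  sort-↭ []       = ↭-refl
  sort-↭ (x ∷ xs) = ↭-trans (insert-↭ x (sort xs)) (↭-prep x (sort-↭ xs))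

  module _ {P : A → Set} (R-total : ∀ {x y} → P x → P y → R x y ⊎ R y x)
           (R-trans : ∀ {x y z} → R x y → R y z → R x z) where

    insert-sorted : ∀ {x ys} → P x → All P ys → AllPairs R ys → AllPairs R (insert x ys)
    insert-sorted {ys = []} _ _ _ = [] ∷ []
    insert-sorted {x} {y ∷ ys} px (py ∷ pys) (yR ∷ sorted) with R? x y
    ... | yes xRy = (xRy ∷ All.map (R-trans xRy) yR) ∷ yR ∷ sorted
    ... | no ¬xRy = All-resp-↭ (↭-sym (insert-↭ x ys)) (yRx ∷ yR) ∷ insert-sorted px pys sorted
      where
        yRx : R y x
        yRx = [ (λ xRy → ⊥-elim (¬xRy xRy)) , id ]′ (R-total px py)

    sort-sorted : ∀ {xs} → All P xs → AllPairs R (sort xs)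
    sort-sorted {[]}     []         = []
    sort-sorted {x ∷ xs} (px ∷ pxs) =
      insert-sorted px (All-resp-↭ (↭-sym (sort-↭ xs)) pxs) (sort-sorted pxs)

AllPairs-lookup : ∀ {A : Set} {R : A → A → Set} {xs} → AllPairs R xs →
                  ∀ {i j : Fin (length xs)} → i <ᶠ j → R (lookup xs i) (lookup xs j)
AllPairs-lookup (xR ∷ _) {zero}  {suc j} _         = All.lookup xR (∈-lookup j)
AllPairs-lookup (_ ∷ xsR) {suc i} {suc j} (s≤s i<j) = AllPairs-lookup xsR i<j

MonotoneEnumeration : ∀ {n} → (Fin n → Set) → (Fin n → Fin n → Set) → Set
MonotoneEnumeration {n} P R =
  Σ ℕ λ ℓ → Σ (Fin (suc ℓ) → Fin n) λ f →
    Injective _≡_ _≡_ f × (∀ j → P (f j)) × (∀ u → P u → ∃ λ j → f j ≡ u) ×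
    (∀ j k → toℕ j ≤ toℕ k → R (f j) (f k))

monotoneEnumeration : ∀ {n} {P : Fin n → Set} {R : Fin n → Fin n → Set} →
                      (∀ u → Dec (P u)) → (∀ u v → Dec (R u v)) → (∀ {u} → R u u) →
                      (∀ {u v w} → R u v → R v w → R u w) →
                      (∀ {u v} → P u → P v → R u v ⊎ R v u) → ∃ P → MonotoneEnumeration P R
monotoneEnumeration {n} {P} {R} P? R? R-refl R-trans R-total (u , Pu) =
  enumerate (sort candidates)
    (sort-sorted R-total R-trans (all-filter P? (allFin n)))
    (PermutationSetoid.Unique-resp-↭ (setoid (Fin n)) (↭⇒↭ₛ (↭-sym (sort-↭ candidates)))
      (Unique.filter⁺ P? (Unique.allFin⁺ n)))
    (All-resp-↭ (↭-sym (sort-↭ candidates)) (all-filter P? (allFin n)))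
    (λ v Pv → ∈-resp-↭ (↭-sym (sort-↭ candidates)) (∈-filter⁺ P? (∈-allFin v) Pv))
  where
    open InsertionSort R R?

    candidates : List (Fin n)
    candidates = filter P? (allFin n)

    enumerate : ∀ zs → AllPairs R zs → Unique zs → All P zs → (∀ v → P v → v ∈ zs) →
                MonotoneEnumeration P R
    enumerate [] _ _ _ complete with complete u Pu
    ... | ()
    enumerate zs@(_ ∷ zs') sorted unique allP complete =
      length zs' , lookup zs , injective , (λ j → All.lookup allP (∈-lookup j)) , cover , monotone
      where
        injective : Injective _≡_ _≡_ (lookup zs)
        injective {i} {j} eq with <ᶠ-cmp i j
        ... | tri< i<j _ _ = ⊥-elim (AllPairs-lookup unique i<j eq)
        ... | tri≈ _ i≡j _ = i≡j
        ... | tri> _ _ j<i = ⊥-elim (AllPairs-lookup unique j<i (sym eq))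

        cover : ∀ v → P v → ∃ λ j → lookup zs j ≡ v
        cover v Pv = index (complete v Pv) , sym (lookup-index (complete v Pv))

        monotone : ∀ j k → toℕ j ≤ toℕ k → R (lookup zs j) (lookup zs k)
        monotone j k j≤k with m≤n⇒m<n∨m≡n j≤k
        ... | inj₁ j<k = AllPairs-lookup sorted j<k
        ... | inj₂ j≡k rewrite toℕ-injective j≡k = R-refl

module LevelComponentFacts {n : ℕ} (G : Graph n) (claw-free : ClawFree G)
                           (even-hole-free : EvenHoleFree G) (u0 u1 : Fin n)
                           (p : ℕ) (C : Fin n → Set)
                           (component : Levels.LevelComponent G u0 u1 (suc p) C) where
  open GraphBasics G
  open Levels G u0 u1
  open LevelFacts G u0 u1
  open ClawFreeEvenHoleFreeLevels G claw-free even-hole-free u0 u1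

  C⊆L : ∀ {v} → C v → L (suc p) v
  C⊆L = proj₁ (proj₂ component) _

  C-closed : ∀ {x y} → C x → L (suc p) y → E G x y → C y
  C-closed = proj₂ (proj₂ (proj₂ component)) _ _

  Nplus⊆C : ∀ {u} → Upper p C u → Nplus p u ⊆ᵥ C
  Nplus⊆C (lu , w , Cw , uw) v (uv , lv) with v ≟ᶠ w
  ... | yes refl = Cw
  ... | no v≢w   = C-closed Cw lv (up-clique lu (C⊆L Cw) lv uw uv (v≢w ∘ sym))

  twoClique-swap : ∀ {A B K} → TwoClique G C A B K → TwoClique G C B A K
  twoClique-swap (a , b , k , partition , A∩B , A∩K , B∩K , AK , BK , A-B) =
    b , a , k , (λ v → swap₁₂ ∘ proj₁ (partition v) , proj₂ (partition v) ∘ swap₁₂) ,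
    (λ v Bv Av → A∩B v Av Bv) , B∩K , A∩K , BK , AK , (λ y x By Ax xy → A-B x y Ax By (E-sym xy))
    where
      swap₁₂ : ∀ {X Y Z : Set} → X ⊎ Y ⊎ Z → Y ⊎ X ⊎ Z
      swap₁₂ (inj₁ x)        = inj₂ (inj₁ x)
      swap₁₂ (inj₂ (inj₁ y)) = inj₁ y
      swap₁₂ (inj₂ (inj₂ z)) = inj₂ (inj₂ z)

  Nplus≐A∪K : ∀ {A B K u a} → TwoClique G C A B K → Upper p C u → A a → E G u a →
              Nplus p u ≐ᵥ (λ v → A v ⊎ K v)
  Nplus≐A∪K {A} {B} {K} {u} {a}
            (_ , (b , Bb) , (k , Kk) , partition , A∩B , A∩K , B∩K , AK , BK , A-B) U Aa ua =
    Nplus⊆AK , AK⊆Nplus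
    where
      lu : L p u
      lu = proj₁ U

      lA : ∀ {x} → A x → L (suc p) x
      lA Ax = C⊆L (proj₂ (partition _) (inj₁ Ax))
      lB : ∀ {x} → B x → L (suc p) x
      lB Bx = C⊆L (proj₂ (partition _) (inj₂ (inj₁ Bx)))
      lK : ∀ {x} → K x → L (suc p) x
      lK Kx = C⊆L (proj₂ (partition _) (inj₂ (inj₂ Kx)))

      A≢B : ∀ {x y} → A x → B y → x ≢ y
      A≢B Ax By refl = A∩B _ Ax By

      A-K : ∀ {x y} → A x → K y → E G x y
      A-K Ax Ky = AK _ _ (inj₁ Ax) (inj₂ Ky) λ { refl → A∩K _ Ax Ky }
      B-K : ∀ {x y} → B x → K y → E G x y
      B-K Bx Ky = BK _ _ (inj₁ Bx) (inj₂ Ky) λ { refl → B∩K _ Bx Ky }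

      ¬belowBoth : ∀ {w x y} → L p w → A x → B y → E G w x → E G w y → ⊥
      ¬belowBoth lw Ax By wx wy = A-B _ _ Ax By (up-clique lw (lA Ax) (lB By) wx wy (A≢B Ax By))

      K⊆N : ∀ {x} → K x → E G u x
      K⊆N {x} Kx with E? u x
      ... | yes ux = ux
      ... | no ¬ux with parent (lK Kx) | parent (lB Bb)
      ... | y , ly , yx | z , lz , zb with E? y a | E? z x
      ... | no ¬ya | _ = ⊥-elim (noInducedP₄ lu (lA Aa) (lK Kx) ly ua (A-K Aa Kx) (E-sym yx)
                                  ¬ux (¬ya ∘ E-sym) λ { refl → ¬ux yx })
      ... | yes ya | yes zx = ⊥-elim (noInducedP₄ lu (lA Aa) (lK Kx) lz ua (A-K Aa Kx) (E-sym zx)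
                                       ¬ux (λ az → ¬belowBoth lz Aa Bb (E-sym az) zb)
                                       λ { refl → ¬ux zx })
      ... | yes ya | no ¬zx = ⊥-elim (noInducedP₄ lz (lB Bb) (lK Kx) ly zb (B-K Bb Kx) (E-sym yx)
                                       ¬zx (λ by → ¬belowBoth ly Aa Bb ya (E-sym by))
                                       λ { refl → ¬belowBoth ly Aa Bb ya zb })

      A⊆N : ∀ {x} → A x → E G u x
      A⊆N {x} Ax with E? u x
      ... | yes ux = ux
      ... | no ¬ux = ⊥-elim (claw-free k u x b (L-<⇒≢ lu (lA Ax) ≤-refl)
                              (L-<⇒≢ lu (lB Bb) ≤-refl)
                              (A≢B Ax Bb) (E-sym (K⊆N Kk)) (E-sym (A-K Ax Kk)) (E-sym (B-K Bb Kk))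
                              ¬ux (¬belowBoth lu Aa Bb ua) (A-B _ _ Ax Bb))

      Nplus⊆AK : Nplus p u ⊆ᵥ (λ v → A v ⊎ K v)
      Nplus⊆AK v uv⁺ with proj₁ (partition v) (Nplus⊆C U v uv⁺)
      ... | inj₁ Av        = inj₁ Av
      ... | inj₂ (inj₁ Bv) = ⊥-elim (¬belowBoth lu Aa Bv ua (proj₁ uv⁺))
      ... | inj₂ (inj₂ Kv) = inj₂ Kv

      AK⊆Nplus : (λ v → A v ⊎ K v) ⊆ᵥ Nplus p u
      AK⊆Nplus v (inj₁ Av) = A⊆N Av , lA Av
      AK⊆Nplus v (inj₂ Kv) = K⊆N Kv , lK Kv

  upperNeighbourhood-2clique : (A B K : Fin n → Set) → TwoClique G C A B K →
                               ∀ u → Upper p C u →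
                               (Nplus p u ≐ᵥ (λ v → A v ⊎ K v))
                               ⊎ (Nplus p u ≐ᵥ (λ v → B v ⊎ K v))
  upperNeighbourhood-2clique A B K
      tc@((a , Aa) , (b , Bb) , _ , partition , A∩B , A∩K , B∩K , AK , BK , A-B) u U@(lu , w , Cw , uw)
    with proj₁ (partition w) Cw
  ... | inj₁ Aw        = inj₁ (Nplus≐A∪K tc U Aw uw)
  ... | inj₂ (inj₁ Bw) = inj₂ (Nplus≐A∪K (twoClique-swap tc) U Bw uw)
  ... | inj₂ (inj₂ Kw) with E? u a | E? u b
  ... | yes ua | _      = inj₁ (Nplus≐A∪K tc U Aa ua)
  ... | no _   | yes ub = inj₂ (Nplus≐A∪K (twoClique-swap tc) U Bb ub)
  ... | no ¬ua | no ¬ub =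
    ⊥-elim (claw-free w u a b (L-<⇒≢ lu (C⊆L (inC (inj₁ Aa))) ≤-refl)
                             (L-<⇒≢ lu (C⊆L (inC (inj₂ (inj₁ Bb)))) ≤-refl)
                             (λ { refl → A∩B _ Aa Bb }) (E-sym uw)
                             (AK _ _ (inj₂ Kw) (inj₁ Aa) λ { refl → A∩K _ Aa Kw })
                             (BK _ _ (inj₂ Kw) (inj₁ Bb) λ { refl → B∩K _ Bb Kw })
                             ¬ua ¬ub (A-B _ _ Aa Bb))
    where
      inC : ∀ {v} → A v ⊎ B v ⊎ K v → C v
      inC = proj₂ (partition _)

  module _ (clique : Clique G C) where

    private
      c₀ : Fin n
      c₀ = proj₁ (proj₁ component)

      Cc₀ : C c₀
      Cc₀ = proj₂ (proj₁ component)

    C? : ∀ w → Dec (C w)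
    C? w = map′ fromNeighbour toNeighbour (L? (suc p) w ×-dec (w ≟ᶠ c₀ ⊎-dec E? c₀ w))
      where
        fromNeighbour : L (suc p) w × (w ≡ c₀ ⊎ E G c₀ w) → C w
        fromNeighbour (_  , inj₁ refl) = Cc₀
        fromNeighbour (lw , inj₂ c₀w)  = C-closed Cc₀ lw c₀w
        toNeighbour : C w → L (suc p) w × (w ≡ c₀ ⊎ E G c₀ w)
        toNeighbour Cw with w ≟ᶠ c₀
        ... | yes w≡c₀ = C⊆L Cw , inj₁ w≡c₀
        ... | no w≢c₀  = C⊆L Cw , inj₂ (clique c₀ w Cc₀ Cw (w≢c₀ ∘ sym))

    Upper? : ∀ u → Dec (Upper p C u)
    Upper? u = L? p u ×-dec any? (λ w → C? w ×-dec E? u w)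

    Nplus? : ∀ u v → Dec (Nplus p u v)
    Nplus? u v = E? u v ×-dec L? (suc p) v

    Nplus-comparable : ∀ {u u'} → Upper p C u → Upper p C u' →
                       Nplus p u ⊆ᵥ Nplus p u' ⊎ Nplus p u' ⊆ᵥ Nplus p u
    Nplus-comparable {u} {u'} U U' with any? (λ a → Nplus? u a ×-dec ¬? (Nplus? u' a))
    ... | no ¬witness = inj₁ u⊆u'
      where
        u⊆u' : Nplus p u ⊆ᵥ Nplus p u'
        u⊆u' v uv with Nplus? u' v
        ... | yes u'v = u'v
        ... | no ¬u'v = ⊥-elim (¬witness (v , uv , ¬u'v))
    ... | yes (a , ua , ¬u'a) = inj₂ u'⊆u
      where
        u'⊆u : Nplus p u' ⊆ᵥ Nplus p u
        u'⊆u v u'v with Nplus? u v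
        ... | yes uv = uv
        ... | no ¬uv = ⊥-elim (noInducedP₄ (proj₁ U) (proj₂ ua) (proj₂ u'v) (proj₁ U')
                                 (proj₁ ua) av (E-sym (proj₁ u'v))
                                 (λ uv → ¬uv (uv , proj₂ u'v))
                                 (λ au' → ¬u'a (E-sym au' , proj₂ ua))
                                 λ { refl → ¬u'a ua })
          where
            av : E G a v
            av = clique a v (Nplus⊆C U a ua) (Nplus⊆C U' v u'v) λ { refl → ¬u'a u'v }

    upperOfC₀ : ∃ (Upper p C)
    upperOfC₀ with parent (C⊆L Cc₀)
    ... | y , ly , yc₀ = y , ly , c₀ , Cc₀ , yc₀

    upperNeighbourhood-chain :
      Σ ℕ λ ℓ → Σ (Fin (suc ℓ) → Fin n) λ f →
        Injective _≡_ _≡_ f ×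
        (∀ j → Upper p C (f j)) ×
        (∀ u → Upper p C u → ∃ λ j → f j ≡ u) ×
        (∀ j k → toℕ j ≤ toℕ k → Nplus p (f j) ⊆ᵥ Nplus p (f k)) ×
        (Nplus p (f (fromℕ ℓ)) ≐ᵥ C)
    upperNeighbourhood-chain
      with monotoneEnumeration Upper? (λ u u' → all? (λ v → Nplus? u v →-dec Nplus? u' v))
                               (λ v → id) (λ u⊆v v⊆w x → v⊆w x ∘ u⊆v x) Nplus-comparable
                               upperOfC₀
    ... | ℓ , f , injective , f∈U , cover , monotone =
      ℓ , f , injective , f∈U , cover , monotone , Nplus⊆C (f∈U (fromℕ ℓ)) , C⊆last
      where
        C⊆last : C ⊆ᵥ Nplus p (f (fromℕ ℓ))
        C⊆last c Cc with parent (C⊆L Cc)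
        ... | y , ly , yc with cover y (ly , c , Cc , yc)
        ... | j , refl = monotone j (fromℕ ℓ) (≤fromℕ j) c (yc , C⊆L Cc)

lemma2p7 : ∀ {n : ℕ} (G : Graph n) → ClawFree G → EvenHoleFree G →
    (u0 u1 : Fin n) → E G u0 u1 →
    (p : ℕ) (C : Fin n → Set) → Levels.LevelComponent G u0 u1 (suc p) C →
    ((A B K : Fin n → Set) → TwoClique G C A B K →
       ∀ u → Levels.Upper G u0 u1 p C u →
         (Levels.Nplus G u0 u1 p u ≐ᵥ (λ v → A v ⊎ K v))
         ⊎ (Levels.Nplus G u0 u1 p u ≐ᵥ (λ v → B v ⊎ K v)))
    ×
    (Clique G C →
       Σ ℕ λ ℓ → Σ (Fin (suc ℓ) → Fin n) λ f →
         Injective _≡_ _≡_ f ×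
         (∀ j → Levels.Upper G u0 u1 p C (f j)) ×
         (∀ u → Levels.Upper G u0 u1 p C u → ∃ λ j → f j ≡ u) ×
         (∀ j k → toℕ j ≤ toℕ k →
            Levels.Nplus G u0 u1 p (f j) ⊆ᵥ Levels.Nplus G u0 u1 p (f k)) ×
         (Levels.Nplus G u0 u1 p (f (fromℕ ℓ)) ≐ᵥ C))
lemma2p7 G claw-free even-hole-free u0 u1 _ p C component =
  upperNeighbourhood-2clique , upperNeighbourhood-chain
  where open LevelComponentFacts G claw-free even-hole-free u0 u1 p C component
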